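{- In the setting described in the context, let $H$ be a subgraph of $G'$ with exactly $k$ rainbow arcs. If these rainbow arcs have fewer than $k$ distinct colours, then $\Lambda_A(H)=0$ for every $A\in\{0,1\}^{s\times k}$.
   Context: Let $G=(V,E)$ be an undirected simple loopless graph with $n$ vertices, a specified edge $v_1v_2\in E$, an edge colouring $c:E\to\{1,\ldots,s\}$, an edge weighting $w:E\to\{0,1\}$, and a positive integer $k$. Fix a total order $<$ on $V$. Let $\mathbf F=\operatorname{GF}(2^{1+\lceil\log_2 n\rceil})$ (characteristic 2) and let $\mathbf G$ be the polynomial ring over $\mathbf F$ in indeterminates $\mathtt R_{uv}$ ($uv\in E$), $\mathtt X_{uv}$ ($uv\in E\setminus\{v_1v_2\}$), $\mathtt W,\mathtt Y,\mathtt Z$. Let $A\in\{0,1\}^{s\times k}$ have rows $a_1^{\mathsf T},\dots,a_s^{\mathsf T}$ and let $b\in\{0,1\}^k$; $a^{\mathsf T}b$ is computed mod 2. Define the directed multigraph $G'$ on $V$ with labelled arcs: (i) self-loops $(u,u)$ for each $u\in V\setminus\{v_1,v_2\}$, labelled $\lambda_{b,A}((u,u))=\mathtt Z$; (ii) rainbow arcs $(u,v)$ and $(v,u)$ for each $uv\in E$, except that the arc $(v_2,v_1)$ is omitted, labelled $\lambda_{b,A}((u,v))=(a_{c(uv)}^{\mathsf T}b)\mathtt R_{uv}\mathtt W^{w(uv)}$ if $u<v$ and $(1+a_{c(uv)}^{\mathsf T}b)\mathtt R_{uv}\mathtt W^{w(uv)}$ if $u>v$; the colour of rainbow arc $(u,v)$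 is $c(uv)$; (iii) extra arcs $\langle u,v\rangle$ and $\langle v,u\rangle$ for each $uv\in E\setminus\{v_1v_2\}$, both labelled $\mathtt X_{uv}\mathtt Y$. For a subgraph (arc set) $H$ of $G'$, $\lambda_{b,A}(H)=\prod_{e\in E(H)}\lambda_{b,A}(e)$ and $\Lambda_A(H)=\sum_{b\in\{0,1\}^k}\lambda_{b,A}(H)$. -}

module Defs where

open import Level using (Level; 0ℓ)
open import Data.Nat using (ℕ; zero; suc)
open import Data.Bool using (Bool; true; false; if_then_else_; _∧_; _xor_)
open import Data.Fin using (Fin)
open import Data.Fin.Properties using () renaming (_≟_ to _≟ᶠ_)
open import Data.Vec using (Vec; []; _∷_)
open import Data.List using (List; []; _∷_; length; deduplicate)
open import Data.Product using (_×_; _,_)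
open import Data.Sum using (_⊎_)
open import Relation.Nullary using (¬_; does)
open import Relation.Binary using (Rel; IsStrictTotalOrder)
open import Relation.Binary.PropositionalEquality using (_≡_; _≢_)
open import Algebra.Bundles using (CommutativeRing)

record SimpleGraph (n m : ℕ) : Set where
  field
    end₁ end₂ : Fin m → Fin n
    loopless  : ∀ e → end₁ e ≢ end₂ e
    simple    : ∀ e f →
                ((end₁ e ≡ end₁ f × end₂ e ≡ end₂ f) ⊎
                 (end₁ e ≡ end₂ f × end₂ e ≡ end₁ f)) → e ≡ f
open SimpleGraph public

-- Arcs of G' (as raw names; validity is the predicate IsArc below).
--   loop u      : the self-loop (u,u)
--   rb e d      : the rainbow arc along edge e; d = false is (end₁ e, end₂ e),
--                 d = true is (end₂ e, end₁ e)
--   ex e d      : the extra arc ⟨·,·⟩ along edge e, same direction convention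

data Arc (n m : ℕ) : Set where
  loop : Fin n → Arc n m
  rb   : Fin m → Bool → Arc n m
  ex   : Fin m → Bool → Arc n m

module _ {n m : ℕ} (G : SimpleGraph n m) where

  tailᵉ headᵉ : Fin m → Bool → Fin n
  tailᵉ e false = end₁ G e
  tailᵉ e true  = end₂ G e
  headᵉ e false = end₂ G e
  headᵉ e true  = end₁ G e

  IsArc : (v₁ v₂ : Fin n) (e₀ : Fin m) → Arc n m → Set
  IsArc v₁ v₂ e₀ (loop u) = u ≢ v₁ × u ≢ v₂
  IsArc v₁ v₂ e₀ (rb e d) = ¬ (tailᵉ e d ≡ v₂ × headᵉ e d ≡ v₁)
  IsArc v₁ v₂ e₀ (ex e d) = e ≢ e₀

rainbowColours : ∀ {n m s} → (Fin m → Fin s) → List (Arc n m) → List (Fin s)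
rainbowColours c [] = []
rainbowColours c (loop u ∷ H) = rainbowColours c H
rainbowColours c (rb e d ∷ H) = c e ∷ rainbowColours c H
rainbowColours c (ex e d ∷ H) = rainbowColours c H

numRainbow : ∀ {n m} → List (Arc n m) → ℕ
numRainbow [] = 0
numRainbow (loop u ∷ H) = numRainbow H
numRainbow (rb e d ∷ H) = suc (numRainbow H)
numRainbow (ex e d ∷ H) = numRainbow H

numDistinct : ∀ {s} → List (Fin s) → ℕ
numDistinct xs = length (deduplicate _≟ᶠ_ xs)

dot : ∀ {k} → Vec Bool k → Vec Bool k → Bool
dot [] [] = false
dot (x ∷ xs) (y ∷ ys) = (x ∧ y) xor dot xs ys

module Labels {c ℓ : Level} (R : CommutativeRing c ℓ) where
  open CommutativeRing R

  ⟦_⟧ : Bool → Carrier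
  ⟦ false ⟧ = 0#
  ⟦ true  ⟧ = 1#

  powB : Carrier → Bool → Carrier
  powB x false = 1#
  powB x true  = x

  sumB : (k : ℕ) → (Vec Bool k → Carrier) → Carrier
  sumB zero f = f []
  sumB (suc k) f = sumB k (λ v → f (false ∷ v)) + sumB k (λ v → f (true ∷ v))

  prodL : List Carrier → Carrier
  prodL [] = 1#
  prodL (x ∷ xs) = x * prodL xs

  module _ {n m s k : ℕ} (G : SimpleGraph n m)
           {_<ᵥ_ : Rel (Fin n) 0ℓ} (ord : IsStrictTotalOrder _≡_ _<ᵥ_)
           (col : Fin m → Fin s) (wt : Fin m → Bool)
           (RR XX : Fin m → Carrier) (W Y Z : Carrier) where
    open IsStrictTotalOrder ord using (_<?_)

    lab : (A : Fin s → Vec Bool k) → Vec Bool k → Arc n m → Carrier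
    lab A b (loop u) = Z
    lab A b (rb e d) =
      (if does (tailᵉ G e d <? headᵉ G e d)
         then ⟦ dot (A (col e)) b ⟧
         else (1# + ⟦ dot (A (col e)) b ⟧))
      * (RR e * powB W (wt e))
    lab A b (ex e d) = XX e * Y

    labH : (A : Fin s → Vec Bool k) → Vec Bool k → List (Arc n m) → Carrier
    labH A b H = prodL (Data.List.map (lab A b) H)

    Λ : (A : Fin s → Vec Bool k) → List (Arc n m) → Carrier
    Λ A H = sumB k (λ b → labH A b H)

-- Each rainbow label depends on b only through a_c·b for the colours c occurring in H. Fewer than k
-- distinct colours give fewer than k vectors a_c in GF(2)^k, so by Gaussian elimination some z ≠ 0
-- is orthogonal to all of them. Then b ↦ λ_b(H) is invariant under b ↦ b ⊕ z, the terms of Λ_A(H)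
-- cancel in pairs {b, b ⊕ z}, and the sum vanishes in characteristic 2.

module Submission where

open import Defs
open import Level using (Level; 0ℓ)
open import Function using (_∘_)
open import Data.Empty using (⊥-elim)
open import Data.Nat using (ℕ; zero; suc; _<_; _≤_; s≤s)
open import Data.Bool using (Bool; true; false; _∧_; _xor_)
open import Data.Bool.Properties
  using (∧-zeroʳ; xor-same; xor-comm; xor-identityʳ; ∧-identityʳ; ∧-distribˡ-xor; ∧-distribʳ-xor; ¬-not; xor-∧-commutativeRing)
  renaming (_≟_ to _≟ᵇ_)
open import Data.Fin using (Fin)
open import Data.Fin.Properties using () renaming (_≟_ to _≟ᶠ_)
open import Data.Vec using (Vec; []; _∷_; head; tail; replicate; zipWith)
open import Data.Vec.Properties using (∷-injectiveʳ)
open import Data.List using (List; []; _∷_; map; length; deduplicate)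
open import Data.List.Properties using (length-map; length-removeAt)
open import Data.List.Relation.Unary.All as All using (All; []; _∷_)
open import Data.List.Relation.Unary.All.Properties using (─⁻; ¬Any⇒All¬) renaming (map⁻ to All-map⁻)
open import Data.List.Relation.Unary.Any as Any using (Any; any?; _─_)
open import Data.List.Relation.Unary.Any.Properties using (lookup-result)
open import Data.List.Membership.Propositional.Properties using (∈-deduplicate⁺)
open import Data.List.Relation.Unary.Unique.Propositional using (Unique)
open import Data.Product using (_×_; _,_; ∃)
open import Data.Sum using (_⊎_)
open import Relation.Nullary using (yes; no)
open import Relation.Binary using (Rel; IsStrictTotalOrder)
open import Relation.Binary.PropositionalEquality using (_≡_; _≢_; refl; sym; trans; cong; cong₂; subst)
open import Algebra.Bundles using (CommutativeRing)
open import Algebra.Properties.CommutativeSemigroup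
  (CommutativeRing.+-commutativeSemigroup xor-∧-commutativeRing) using () renaming (interchange to xor-interchange)

infixl 6 _⊕_

_⊕_ : ∀ {k} → Vec Bool k → Vec Bool k → Vec Bool k
_⊕_ = zipWith _xor_

dot-⊕ˡ : ∀ {k} (u v b : Vec Bool k) → dot (u ⊕ v) b ≡ dot u b xor dot v b
dot-⊕ˡ [] [] [] = refl
dot-⊕ˡ (x ∷ u) (y ∷ v) (z ∷ b) =
  trans (cong₂ _xor_ (∧-distribʳ-xor z x y) (dot-⊕ˡ u v b))
        (xor-interchange (x ∧ z) (y ∧ z) (dot u b) (dot v b))

dot-⊕ʳ : ∀ {k} (a u v : Vec Bool k) → dot a (u ⊕ v) ≡ dot a u xor dot a v
dot-⊕ʳ [] [] [] = refl
dot-⊕ʳ (x ∷ a) (y ∷ u) (z ∷ v) =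
  trans (cong₂ _xor_ (∧-distribˡ-xor x y z) (dot-⊕ʳ a u v))
        (xor-interchange (x ∧ y) (x ∧ z) (dot a u) (dot a v))

dot-zeroʳ : ∀ {k} (a : Vec Bool k) → dot a (replicate k false) ≡ false
dot-zeroʳ [] = refl
dot-zeroʳ (x ∷ a) = cong₂ _xor_ (∧-zeroʳ x) (dot-zeroʳ a)

eliminate : ∀ {k} → Vec Bool (suc k) → Vec Bool (suc k) → Vec Bool k
eliminate p (false ∷ v) = v
eliminate p (true ∷ v) = v ⊕ tail p

backSubstitute : ∀ {k} → Vec Bool (suc k) → Vec Bool k → Vec Bool (suc k)
backSubstitute p z = dot (tail p) z ∷ z

dot-backSubstitute : ∀ {k} (p v : Vec Bool (suc k)) z →
  dot v (backSubstitute p z) ≡ dot (eliminate p v) z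
dot-backSubstitute p (false ∷ v) z = refl
dot-backSubstitute p (true ∷ v) z = trans (xor-comm (dot (tail p) z) (dot v z)) (sym (dot-⊕ˡ v (tail p) z))

dot-backSubstitute-pivot : ∀ {k} (p : Vec Bool (suc k)) z → head p ≡ true → dot p (backSubstitute p z) ≡ false
dot-backSubstitute-pivot (true ∷ a) z refl = xor-same (dot a z)

dot-firstUnit : ∀ {k} (v : Vec Bool (suc k)) → dot v (true ∷ replicate k false) ≡ head v
dot-firstUnit (x ∷ v) = trans (cong₂ _xor_ (∧-identityʳ x) (dot-zeroʳ v)) (xor-identityʳ x)

length-─< : ∀ {A : Set} {P : A → Set} {k} {xs : List A} (p : Any P xs) → length xs < suc k → length (xs ─ p) < k
length-─< {xs = x ∷ xs} p (s≤s |xs|<k) rewrite length-removeAt (x ∷ xs) (Any.index p) = |xs|<k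

∃-nonzero-orthogonal : ∀ {k} (D : List (Vec Bool k)) → length D < k →
  ∃ λ z → z ≢ replicate k false × All (λ a → dot a z ≡ false) D
∃-nonzero-orthogonal {suc k} D |D|<k with any? (λ a → head a ≟ᵇ true) D
... | no noPivot =
  true ∷ replicate k false , (λ ()) ,
  All.map (λ {a} head≢true → trans (dot-firstUnit a) (¬-not head≢true)) (¬Any⇒All¬ D noPivot)
... | yes pivot =
  let z , z≢0 , z⊥ = ∃-nonzero-orthogonal (map (eliminate p) (D ─ pivot)) reduced<k
  in backSubstitute p z , z≢0 ∘ ∷-injectiveʳ ,
     ─⁻ pivot (dot-backSubstitute-pivot p z (lookup-result pivot))
       (All.map (λ {v} → trans (dot-backSubstitute p v z)) (All-map⁻ z⊥))
  where
  p : Vec Bool (suc k)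
  p = Any.lookup pivot
  reduced<k : length (map (eliminate p) (D ─ pivot)) < k
  reduced<k = subst (_< k) (sym (length-map (eliminate p) (D ─ pivot))) (length-─< pivot |D|<k)

∃-nonzero-orthogonal-colours : ∀ {s k} (A : Fin s → Vec Bool k) (cs : List (Fin s)) → numDistinct cs < k →
  ∃ λ z → z ≢ replicate k false × All (λ c → dot (A c) z ≡ false) cs
∃-nonzero-orthogonal-colours {s} {k} A cs fewColours =
  let z , z≢0 , z⊥ = ∃-nonzero-orthogonal (map A distinct) (subst (_< k) (sym (length-map A distinct)) fewColours)
  in z , z≢0 , All.tabulate (λ c∈cs → All.lookup (All-map⁻ z⊥) (∈-deduplicate⁺ _≟ᶠ_ c∈cs))
  where
  distinct : List (Fin s)
  distinct = deduplicate _≟ᶠ_ cs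

module _ {c ℓ : Level} (R : CommutativeRing c ℓ) where
  open CommutativeRing R renaming (refl to ≈-refl; sym to ≈-sym; trans to ≈-trans)
  open Labels R
  open import Relation.Binary.Reasoning.Setoid setoid

  sumB-cong : ∀ k {f g : Vec Bool k → Carrier} → (∀ b → f b ≈ g b) → sumB k f ≈ sumB k g
  sumB-cong zero f≈g = f≈g []
  sumB-cong (suc k) f≈g = +-cong (sumB-cong k (f≈g ∘ (false ∷_))) (sumB-cong k (f≈g ∘ (true ∷_)))

  sumB-translate : ∀ k (f : Vec Bool k → Carrier) z → sumB k (λ b → f (b ⊕ z)) ≈ sumB k f
  sumB-translate zero f [] = ≈-refl
  sumB-translate (suc k) f (false ∷ z) =
    +-cong (sumB-translate k (f ∘ (false ∷_)) z) (sumB-translate k (f ∘ (true ∷_)) z)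
  sumB-translate (suc k) f (true ∷ z) =
    ≈-trans (+-cong (sumB-translate k (f ∘ (true ∷_)) z) (sumB-translate k (f ∘ (false ∷_)) z)) (+-comm _ _)

  x+x≈0 : 1# + 1# ≈ 0# → ∀ x → x + x ≈ 0#
  x+x≈0 char2 x = begin
    x + x             ≈⟨ ≈-sym (+-cong (*-identityˡ x) (*-identityˡ x)) ⟩
    1# * x + 1# * x   ≈⟨ ≈-sym (distribʳ x 1# 1#) ⟩
    (1# + 1#) * x     ≈⟨ *-congʳ char2 ⟩
    0# * x            ≈⟨ zeroˡ x ⟩
    0#                ∎

  sumB-periodic≈0 : 1# + 1# ≈ 0# → ∀ k {f : Vec Bool k → Carrier} {z} → z ≢ replicate k false →
    (∀ b → f (b ⊕ z) ≈ f b) → sumB k f ≈ 0#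
  sumB-periodic≈0 char2 zero {z = []} z≢0 _ = ⊥-elim (z≢0 refl)
  sumB-periodic≈0 char2 (suc k) {z = false ∷ z} z≢0 periodic = begin
    _ + _    ≈⟨ +-cong (sumB-periodic≈0 char2 k (z≢0 ∘ cong (false ∷_)) (periodic ∘ (false ∷_)))
                       (sumB-periodic≈0 char2 k (z≢0 ∘ cong (false ∷_)) (periodic ∘ (true ∷_))) ⟩
    0# + 0#  ≈⟨ +-identityʳ 0# ⟩
    0#       ∎
  sumB-periodic≈0 char2 (suc k) {f} {true ∷ z} _ periodic = begin
    sumB k (f ∘ (false ∷_)) + sumB k (f ∘ (true ∷_))
      ≈⟨ +-congˡ (sumB-cong k (≈-sym ∘ periodic ∘ (true ∷_))) ⟩
    sumB k (f ∘ (false ∷_)) + sumB k (λ b → f (false ∷ b ⊕ z))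
      ≈⟨ +-congˡ (sumB-translate k (f ∘ (false ∷_)) z) ⟩
    sumB k (f ∘ (false ∷_)) + sumB k (f ∘ (false ∷_))
      ≈⟨ x+x≈0 char2 _ ⟩
    0# ∎

  module _ {n m s k : ℕ} (G : SimpleGraph n m)
           {_<ᵥ_ : Rel (Fin n) 0ℓ} (ord : IsStrictTotalOrder _≡_ _<ᵥ_)
           (col : Fin m → Fin s) (wt : Fin m → Bool)
           (RR XX : Fin m → Carrier) (W Y Z : Carrier) (A : Fin s → Vec Bool k) where

    labH-⊕-orthogonal : ∀ {z} H → All (λ c → dot (A c) z ≡ false) (rainbowColours col H) →
      ∀ b → labH G ord col wt RR XX W Y Z A (b ⊕ z) H ≡ labH G ord col wt RR XX W Y Z A b H
    labH-⊕-orthogonal [] _ b = refl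
    labH-⊕-orthogonal (loop u ∷ H) z⊥ b = cong (Z *_) (labH-⊕-orthogonal H z⊥ b)
    labH-⊕-orthogonal (ex e d ∷ H) z⊥ b = cong (XX e * Y *_) (labH-⊕-orthogonal H z⊥ b)
    labH-⊕-orthogonal {z} (rb e d ∷ H) (z⊥e ∷ z⊥) b
      rewrite dot-⊕ʳ (A (col e)) b z | z⊥e | xor-identityʳ (dot (A (col e)) b) =
      cong (_ *_) (labH-⊕-orthogonal H z⊥ b)

lemma5 : ∀ {c ℓ : Level} {n m s : ℕ} (k : ℕ) → 1 ≤ k →
    (G : SimpleGraph n m) →
    (v₁ v₂ : Fin n) (e₀ : Fin m) →
    ((end₁ G e₀ ≡ v₁ × end₂ G e₀ ≡ v₂) ⊎ (end₁ G e₀ ≡ v₂ × end₂ G e₀ ≡ v₁)) →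
    {_<ᵥ_ : Rel (Fin n) 0ℓ} (ord : IsStrictTotalOrder _≡_ _<ᵥ_) →
    (col : Fin m → Fin s) (wt : Fin m → Bool) →
    (R : CommutativeRing c ℓ) →
    CommutativeRing._≈_ R (CommutativeRing._+_ R (CommutativeRing.1# R) (CommutativeRing.1# R)) (CommutativeRing.0# R) →
    (RR XX : Fin m → CommutativeRing.Carrier R) (W Y Z : CommutativeRing.Carrier R) →
    (H : List (Arc n m)) → Unique H → All (IsArc G v₁ v₂ e₀) H →
    numRainbow H ≡ k →
    numDistinct (rainbowColours col H) < k →
    (A : Fin s → Vec Bool k) →
    CommutativeRing._≈_ R (Labels.Λ R {k = k} G ord col wt RR XX W Y Z A H) (CommutativeRing.0# R)
-- Only the number of distinct rainbow colours matters.
lemma5 k _ G _ _ _ _ ord col wt R char2 RR XX W Y Z H _ _ _ fewColours A =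
  let z , z≢0 , z⊥ = ∃-nonzero-orthogonal-colours A (rainbowColours col H) fewColours
  in sumB-periodic≈0 R char2 k z≢0
       (CommutativeRing.reflexive R ∘ labH-⊕-orthogonal R G ord col wt RR XX W Y Z A H z⊥)
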